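{- Let $O$ be a fixed point of $\mathbb{R}^2$, let $n\ge 1$, and let $a_1,a_2,\ldots,a_{2n-1}$ be real numbers such that $a_1,a_3,\ldots,a_{2n-1}$ are all nonzero. Let $A_0\in\mathbb{R}^2$ and let $v\in\mathbb{R}^2$ be a vector with $|OA_0\times v|\neq 0$. Construct points $A_1,\ldots,A_n$ as follows. Put $A_1=A_0+\lambda v$, where $\lambda\in\mathbb{R}$ is the unique number with $|OA_0\times OA_1|=a_1$. For $k=1,\ldots,n-1$, having constructed $A_0,\ldots,A_k$, put $$P=A_k+\frac{1}{a_{2k-1}}\,A_{k-1}A_k,\qquad Q=P+a_{2k}\,OA_k,\qquad A_{k+1}=A_k+a_{2k+1}\,A_kQ .$$ Then $$a_{2k+1}=|OA_k\times OA_{k+1}|\quad (k=0,\ldots,n-1),$$ $$a_{2k}=\frac{|A_kA_{k-1}\times A_kA_{k+1}|}{a_{2k-1}a_{2k+1}}\quad (k=1,\ldots,n-1).$$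
   Context: For points $X,Y\in\mathbb{R}^2$, $XY$ denotes the vector $Y-X$, and $X+cv$ denotes the point obtained by translating $X$ by $c v$. For vectors $v=(v_1,v_2)$, $w=(w_1,w_2)$, $|v\times w|$ denotes the oriented area of the parallelogram spanned by $v$ and $w$, i.e. $|v\times w|=v_1w_2-v_2w_1$ (it can be negative). -}

module Defs where

open import Level using (Level; _⊔_; suc)
open import Algebra.Bundles using (CommutativeRing)
open import Data.Product using (_×_; _,_; proj₁; proj₂; Σ)
open import Relation.Nullary using (¬_)

-- A field: a nontrivial commutative ring with a (total) inverse operation
-- that is a multiplicative inverse on nonzero elements (Lean/Mathlib style).
record Field (c ℓ : Level) : Set (Level.suc (c ⊔ ℓ)) where
  field
    commutativeRing : CommutativeRing c ℓ
  open CommutativeRing commutativeRing public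
  field
    _⁻¹       : Carrier → Carrier
    ⁻¹-cong   : ∀ {x y} → x ≈ y → x ⁻¹ ≈ y ⁻¹
    inverseʳ  : ∀ x → ¬ x ≈ 0# → x * (x ⁻¹) ≈ 1#
    1≉0       : ¬ 1# ≈ 0#

module Plane {c ℓ : Level} (F : Field c ℓ) where
  open Field F

  Pt : Set c
  Pt = Carrier × Carrier

  _≋_ : Pt → Pt → Set ℓ
  (x₁ , x₂) ≋ (y₁ , y₂) = (x₁ ≈ y₁) × (x₂ ≈ y₂)

  vec : Pt → Pt → Pt
  vec (x₁ , x₂) (y₁ , y₂) = (y₁ - x₁ , y₂ - x₂)

  _+ᵥ_·_ : Pt → Carrier → Pt → Pt
  (x₁ , x₂) +ᵥ t · (v₁ , v₂) = (x₁ + t * v₁ , x₂ + t * v₂)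

  -- oriented area |v × w| = v₁ w₂ - v₂ w₁
  cross : Pt → Pt → Carrier
  cross (v₁ , v₂) (w₁ , w₂) = v₁ * w₂ - v₂ * w₁

  ∃!≈ : (Carrier → Set ℓ) → Set (c ⊔ ℓ)
  ∃!≈ P = Σ Carrier (λ x → P x × (∀ y → P y → y ≈ x))

-- Write u = OA_k and m = OA_{k-1}. Then A_kQ = a_{2k-1}⁻¹ (u - m) + a_{2k} u, so by
-- bilinearity and u × u = 0 the point A_{k+1} = A_k + a_{2k+1} A_kQ satisfies
--   u × OA_{k+1} = a_{2k+1} a_{2k-1}⁻¹ (m × u),
--   A_kA_{k-1} × A_kA_{k+1} = a_{2k+1} a_{2k} (m × u).
-- With m × u = a_{2k-1} by induction (the base case being the choice of λ, which
-- solves the linear equation λ (OA₀ × v) = a_1), both identities follow.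
module Submission where

open import Defs
open import Data.Nat using (ℕ; suc; _≤_; _<_; _∸_) renaming (_+_ to _+ℕ_; _*_ to _*ℕ_)
open import Data.Product using (_×_)
open import Relation.Nullary using (¬_)
open import Level using (Level)
open import Algebra.Bundles using (CommutativeRing; RawRing)
open import Data.Nat as ℕ using (zero; s≤s; z≤n)
open import Data.Product using (_,_)
open import Data.Product.Properties using (≡-dec)
open import Data.Maybe using (Maybe; just; nothing)
open import Relation.Nullary.Decidable using (yes; no)
import Relation.Binary.PropositionalEquality as ≡
open ≡ using (_≡_)
import Data.Nat.Properties as ℕ
open import Algebra.Solver.Ring.AlmostCommutativeRing
  using (_-Raw-AlmostCommutative⟶_; fromCommutativeRing)
import Algebra.Properties.Ring as RingProperties
import Algebra.Properties.CommutativeSemigroup as CommutativeSemigroupProperties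
import Algebra.Properties.Semiring.Mult as SemiringMult
import Algebra.Solver.Ring as Solver

-- Ring solver with integer coefficients, integers being formal differences of
-- naturals with one side 0; in this normal form coefficient equality is
-- decidable, which the solver needs to cancel terms such as x - x.
module DifferenceCoefficientSolver {c ℓ : Level} (R : CommutativeRing c ℓ) where
  open CommutativeRing R
  open RingProperties ring using (-0#≈0#; -‿+-comm; ⁻¹-anti-homo‿-; x[y-z]≈xy-xz; [y-z]x≈yx-zx)
  open CommutativeSemigroupProperties +-commutativeSemigroup using (interchange)
  open SemiringMult semiring using (×-homo-+; ×1-homo-*) renaming (_×_ to _·1_)
  open import Relation.Binary.Reasoning.Setoid setoid

  Difference : Set
  Difference = ℕ × ℕ

  normalise : ℕ → ℕ → Difference
  normalise (suc m) (suc n) = normalise m n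
  normalise m n = (m , n)

  ⟦_⟧ : Difference → Carrier
  ⟦ m , n ⟧ = m ·1 1# - n ·1 1#

  -‿+-interchange : ∀ x y u v → (x + y) - (u + v) ≈ (x - u) + (y - v)
  -‿+-interchange x y u v = begin
    (x + y) - (u + v)     ≈⟨ +-congˡ (-‿+-comm u v) ⟨
    (x + y) + (- u + - v) ≈⟨ interchange x y (- u) (- v) ⟩
    (x - u) + (y - v)     ∎

  normalise-sound : ∀ m n → ⟦ normalise m n ⟧ ≈ m ·1 1# - n ·1 1#
  normalise-sound zero    zero    = refl
  normalise-sound zero    (suc n) = refl
  normalise-sound (suc m) zero    = refl
  normalise-sound (suc m) (suc n) = begin
    ⟦ normalise m n ⟧                          ≈⟨ normalise-sound m n ⟩
    m ·1 1# - n ·1 1#                          ≈⟨ +-identityˡ _ ⟨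
    0# + (m ·1 1# - n ·1 1#)                   ≈⟨ +-congʳ (-‿inverseʳ 1#) ⟨
    (1# - 1#) + (m ·1 1# - n ·1 1#)            ≈⟨ -‿+-interchange 1# (m ·1 1#) 1# (n ·1 1#) ⟨
    (1# + m ·1 1#) - (1# + n ·1 1#)            ∎

  _⊕_ : Difference → Difference → Difference
  (m , n) ⊕ (p , q) = normalise (m ℕ.+ p) (n ℕ.+ q)

  _⊗_ : Difference → Difference → Difference
  (m , n) ⊗ (p , q) = normalise (m ℕ.* p ℕ.+ n ℕ.* q) (m ℕ.* q ℕ.+ n ℕ.* p)

  ⊖_ : Difference → Difference
  ⊖ (m , n) = (n , m)

  differences : RawRing _ _
  differences = record
    { Carrier = Difference ; _≈_ = _≡_
    ; _+_ = _⊕_ ; _*_ = _⊗_ ; -_ = ⊖_ ; 0# = (0 , 0) ; 1# = (1 , 0) }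

  ⊕-homo : ∀ d e → ⟦ d ⊕ e ⟧ ≈ ⟦ d ⟧ + ⟦ e ⟧
  ⊕-homo (m , n) (p , q) = begin
    ⟦ normalise (m ℕ.+ p) (n ℕ.+ q) ⟧    ≈⟨ normalise-sound (m ℕ.+ p) (n ℕ.+ q) ⟩
    (m ℕ.+ p) ·1 1# - (n ℕ.+ q) ·1 1#    ≈⟨ +-cong (×-homo-+ 1# m p) (-‿cong (×-homo-+ 1# n q)) ⟩
    (M + P) - (N + Q)                    ≈⟨ -‿+-interchange M P N Q ⟩
    (M - N) + (P - Q)                    ∎
    where M = m ·1 1#; N = n ·1 1#; P = p ·1 1#; Q = q ·1 1#

  ⊗-homo : ∀ d e → ⟦ d ⊗ e ⟧ ≈ ⟦ d ⟧ * ⟦ e ⟧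
  ⊗-homo (m , n) (p , q) = begin
    ⟦ normalise (m ℕ.* p ℕ.+ n ℕ.* q) (m ℕ.* q ℕ.+ n ℕ.* p) ⟧
      ≈⟨ normalise-sound (m ℕ.* p ℕ.+ n ℕ.* q) (m ℕ.* q ℕ.+ n ℕ.* p) ⟩
    (m ℕ.* p ℕ.+ n ℕ.* q) ·1 1# - (m ℕ.* q ℕ.+ n ℕ.* p) ·1 1#
      ≈⟨ +-cong (·1-homo-+* m p n q) (-‿cong (·1-homo-+* m q n p)) ⟩
    (M * P + N * Q) - (M * Q + N * P)    ≈⟨ -‿+-interchange (M * P) (N * Q) (M * Q) (N * P) ⟩
    (M * P - M * Q) + (N * Q - N * P)    ≈⟨ +-congˡ (⁻¹-anti-homo‿- (N * P) (N * Q)) ⟨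
    (M * P - M * Q) - (N * P - N * Q)    ≈⟨ +-cong (x[y-z]≈xy-xz M P Q) (-‿cong (x[y-z]≈xy-xz N P Q)) ⟨
    M * (P - Q) - N * (P - Q)            ≈⟨ [y-z]x≈yx-zx (P - Q) M N ⟨
    (M - N) * (P - Q)                    ∎
    where
    M = m ·1 1#; N = n ·1 1#; P = p ·1 1#; Q = q ·1 1#
    ·1-homo-+* : ∀ i j k l → (i ℕ.* j ℕ.+ k ℕ.* l) ·1 1# ≈ (i ·1 1#) * (j ·1 1#) + (k ·1 1#) * (l ·1 1#)
    ·1-homo-+* i j k l =
      trans (×-homo-+ 1# (i ℕ.* j) (k ℕ.* l)) (+-cong (×1-homo-* i j) (×1-homo-* k l))

  homomorphism : differences -Raw-AlmostCommutative⟶ fromCommutativeRing R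
  homomorphism = record
    { ⟦_⟧    = ⟦_⟧
    ; +-homo = ⊕-homo
    ; *-homo = ⊗-homo
    ; -‿homo = λ { (m , n) → sym (⁻¹-anti-homo‿- (m ·1 1#) (n ·1 1#)) }
    ; 0-homo = -‿inverseʳ 0#
    ; 1-homo = trans (+-cong (+-identityʳ 1#) -0#≈0#) (+-identityʳ 1#)
    }

  _≟-induced_ : ∀ d e → Maybe (⟦ d ⟧ ≈ ⟦ e ⟧)
  d ≟-induced e with ≡-dec ℕ._≟_ ℕ._≟_ d e
  ... | yes ≡.refl = just refl
  ... | no _       = nothing

  open Solver differences (fromCommutativeRing R) homomorphism _≟-induced_ public
    using (solve; _:=_; _:+_; _:-_; _:*_)


module FieldLemmas {c ℓ : Level} (F : Field c ℓ) where
  open Field F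
  open Plane F using (∃!≈)
  open CommutativeSemigroupProperties *-commutativeSemigroup using (xy∙z≈xz∙y)
  open import Relation.Binary.Reasoning.Setoid setoid

  *-inverse-cancelʳ : ∀ {x} y → ¬ x ≈ 0# → y * x * x ⁻¹ ≈ y
  *-inverse-cancelʳ {x} y x≉0 = begin
    y * x * x ⁻¹    ≈⟨ *-assoc y x (x ⁻¹) ⟩
    y * (x * x ⁻¹)  ≈⟨ *-congˡ (inverseʳ x x≉0) ⟩
    y * 1#          ≈⟨ *-identityʳ y ⟩
    y               ∎

  ∃!≈-cong : ∀ {P Q : Carrier → Set ℓ} → (∀ t → P t → Q t) → (∀ t → Q t → P t) → ∃!≈ P → ∃!≈ Q
  ∃!≈-cong P⇒Q Q⇒P (t , Pt , unique) = t , P⇒Q t Pt , λ s Qs → unique s (Q⇒P s Qs)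

  linear-∃!≈ : ∀ {x} → ¬ x ≈ 0# → ∀ b → ∃!≈ (λ t → t * x ≈ b)
  linear-∃!≈ {x} x≉0 b = b * x ⁻¹ , solution , unique
    where
    solution : b * x ⁻¹ * x ≈ b
    solution = trans (xy∙z≈xz∙y b (x ⁻¹) x) (*-inverse-cancelʳ b x≉0)
    unique : ∀ t → t * x ≈ b → t ≈ b * x ⁻¹
    unique t tx≈b = trans (sym (*-inverse-cancelʳ t x≉0)) (*-congʳ tx≈b)

module ConstructionGeometry {c ℓ : Level} (F : Field c ℓ) where
  open Field F
  open Plane F
  open DifferenceCoefficientSolver commutativeRing using (solve; _:=_; _:+_; _:-_; _:*_)
  open FieldLemmas F using (*-inverse-cancelʳ)
  open CommutativeSemigroupProperties *-commutativeSemigroup using (xy∙z≈xz∙y)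
  open import Relation.Binary.Reasoning.Setoid setoid

  ≋-refl : ∀ {X} → X ≋ X
  ≋-refl = refl , refl

  vec-cong : ∀ {X X′ Y Y′} → X ≋ X′ → Y ≋ Y′ → vec X Y ≋ vec X′ Y′
  vec-cong (x₁ , x₂) (y₁ , y₂) = +-cong y₁ (-‿cong x₁) , +-cong y₂ (-‿cong x₂)

  cross-cong : ∀ {u u′ w w′} → u ≋ u′ → w ≋ w′ → cross u w ≈ cross u′ w′
  cross-cong (u₁ , u₂) (w₁ , w₂) = +-cong (*-cong u₁ w₂) (-‿cong (*-cong u₂ w₁))

  cross-vec-+ᵥ : ∀ O X w t → cross (vec O X) (vec O (X +ᵥ t · w)) ≈ t * cross (vec O X) w
  cross-vec-+ᵥ (o₁ , o₂) (x₁ , x₂) (w₁ , w₂) = solve 7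
    (λ o₁ o₂ x₁ x₂ w₁ w₂ t →
      (x₁ :- o₁) :* ((x₂ :+ t :* w₂) :- o₂) :- (x₂ :- o₂) :* ((x₁ :+ t :* w₁) :- o₁)
      := t :* ((x₁ :- o₁) :* w₂ :- (x₂ :- o₂) :* w₁))
    refl o₁ o₂ x₁ x₂ w₁ w₂

  -- The point A_{k+1} built from M = A_{k-1} and K = A_k, with i = a_{2k-1}⁻¹, b = a_{2k}, g = a_{2k+1}.
  nextPoint : (O M K : Pt) (i b g : Carrier) → Pt
  nextPoint O M K i b g = K +ᵥ g · vec K ((K +ᵥ i · vec M K) +ᵥ b · vec O K)

  cross-origin-nextPoint : ∀ O M K i b g →
    cross (vec O K) (vec O (nextPoint O M K i b g)) ≈ g * i * cross (vec O M) (vec O K)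
  cross-origin-nextPoint (o₁ , o₂) (m₁ , m₂) (k₁ , k₂) = solve 9
    (λ o₁ o₂ m₁ m₂ k₁ k₂ i b g →
      let n₁ = k₁ :+ g :* (((k₁ :+ i :* (k₁ :- m₁)) :+ b :* (k₁ :- o₁)) :- k₁)
          n₂ = k₂ :+ g :* (((k₂ :+ i :* (k₂ :- m₂)) :+ b :* (k₂ :- o₂)) :- k₂)
      in (k₁ :- o₁) :* (n₂ :- o₂) :- (k₂ :- o₂) :* (n₁ :- o₁)
         := g :* i :* ((m₁ :- o₁) :* (k₂ :- o₂) :- (m₂ :- o₂) :* (k₁ :- o₁)))
    refl o₁ o₂ m₁ m₂ k₁ k₂

  cross-vertex-nextPoint : ∀ O M K i b g →
    cross (vec K M) (vec K (nextPoint O M K i b g)) ≈ g * b * cross (vec O M) (vec O K)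
  cross-vertex-nextPoint (o₁ , o₂) (m₁ , m₂) (k₁ , k₂) = solve 9
    (λ o₁ o₂ m₁ m₂ k₁ k₂ i b g →
      let n₁ = k₁ :+ g :* (((k₁ :+ i :* (k₁ :- m₁)) :+ b :* (k₁ :- o₁)) :- k₁)
          n₂ = k₂ :+ g :* (((k₂ :+ i :* (k₂ :- m₂)) :+ b :* (k₂ :- o₂)) :- k₂)
      in (m₁ :- k₁) :* (n₂ :- k₂) :- (m₂ :- k₂) :* (n₁ :- k₁)
         := g :* b :* ((m₁ :- o₁) :* (k₂ :- o₂) :- (m₂ :- o₂) :* (k₁ :- o₁)))
    refl o₁ o₂ m₁ m₂ k₁ k₂

  module _ {O M K N : Pt} {α β γ : Carrier} (α≉0 : ¬ α ≈ 0#)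
           (α≈area : α ≈ cross (vec O M) (vec O K))
           (N≋next : N ≋ nextPoint O M K (α ⁻¹) β γ) where

    nextPoint-area : γ ≈ cross (vec O K) (vec O N)
    nextPoint-area = sym (begin
      cross (vec O K) (vec O N)   ≈⟨ cross-cong ≋-refl (vec-cong ≋-refl N≋next) ⟩
      cross (vec O K) (vec O (nextPoint O M K (α ⁻¹) β γ))
                                  ≈⟨ cross-origin-nextPoint O M K (α ⁻¹) β γ ⟩
      γ * α ⁻¹ * cross (vec O M) (vec O K)
                                  ≈⟨ *-congˡ α≈area ⟨
      γ * α ⁻¹ * α                ≈⟨ xy∙z≈xz∙y γ (α ⁻¹) α ⟩
      γ * α * α ⁻¹                ≈⟨ *-inverse-cancelʳ γ α≉0 ⟩
      γ                           ∎)

    nextPoint-coefficient : ¬ γ ≈ 0# → β ≈ cross (vec K M) (vec K N) * (α ⁻¹ * γ ⁻¹)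
    nextPoint-coefficient γ≉0 = sym (begin
      cross (vec K M) (vec K N) * (α ⁻¹ * γ ⁻¹)
        ≈⟨ *-congʳ (cross-cong ≋-refl (vec-cong ≋-refl N≋next)) ⟩
      cross (vec K M) (vec K (nextPoint O M K (α ⁻¹) β γ)) * (α ⁻¹ * γ ⁻¹)
        ≈⟨ *-congʳ (cross-vertex-nextPoint O M K (α ⁻¹) β γ) ⟩
      γ * β * cross (vec O M) (vec O K) * (α ⁻¹ * γ ⁻¹)
        ≈⟨ *-congʳ (*-congˡ α≈area) ⟨
      γ * β * α * (α ⁻¹ * γ ⁻¹)
        ≈⟨ solve 5 (λ a a′ b g g′ → g :* b :* a :* (a′ :* g′) := b :* g :* a :* a′ :* g′)
                 refl α (α ⁻¹) β γ (γ ⁻¹) ⟩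
      β * γ * α * α ⁻¹ * γ ⁻¹
        ≈⟨ *-congʳ (*-inverse-cancelʳ (β * γ) α≉0) ⟩
      β * γ * γ ⁻¹
        ≈⟨ *-inverse-cancelʳ β γ≉0 ⟩
      β ∎)

predecessor-odd-index : ∀ j → 2 *ℕ suc j ∸ 1 ≡ 2 *ℕ j +ℕ 1
predecessor-odd-index j = ≡.trans (ℕ.+-suc j (j +ℕ 0)) (ℕ.+-comm 1 (2 *ℕ j))

module Recurrence {c ℓ : Level} (F : Field c ℓ) where
  open Field F
  open Plane F
  open ConstructionGeometry F

  module _ (O : Pt) (n : ℕ) (a : ℕ → Carrier) (A : ℕ → Pt)
    (odd≉0 : ∀ k → k < n → ¬ a (2 *ℕ k +ℕ 1) ≈ 0#)
    (first-area : a 1 ≈ cross (vec O (A 0)) (vec O (A 1)))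
    (step : ∀ k → 1 ≤ k → k < n →
       A (suc k) ≋ nextPoint O (A (k ∸ 1)) (A k) (a (2 *ℕ k ∸ 1) ⁻¹) (a (2 *ℕ k)) (a (2 *ℕ k +ℕ 1)))
    where

    private
      pred< : ∀ {j} → suc j < n → j < n
      pred< = ℕ.<-trans (ℕ.n<1+n _)

      previous≈ : ∀ j → a (2 *ℕ suc j ∸ 1) ≈ a (2 *ℕ j +ℕ 1)
      previous≈ j = reflexive (≡.cong a (predecessor-odd-index j))

      previous≉0 : ∀ j → j < n → ¬ a (2 *ℕ suc j ∸ 1) ≈ 0#
      previous≉0 j j<n α≈0 = odd≉0 j j<n (trans (sym (previous≈ j)) α≈0)

    odd-area : ∀ k → k < n → a (2 *ℕ k +ℕ 1) ≈ cross (vec O (A k)) (vec O (A (suc k)))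
    odd-area zero    _     = first-area
    odd-area (suc j) j+1<n = nextPoint-area (previous≉0 j (pred< j+1<n))
      (trans (previous≈ j) (odd-area j (pred< j+1<n))) (step (suc j) (s≤s z≤n) j+1<n)

    even-coefficient : ∀ k → 1 ≤ k → k < n →
      a (2 *ℕ k) ≈ cross (vec (A k) (A (k ∸ 1))) (vec (A k) (A (suc k)))
                     * ((a (2 *ℕ k ∸ 1)) ⁻¹ * (a (2 *ℕ k +ℕ 1)) ⁻¹)
    even-coefficient (suc j) _ j+1<n = nextPoint-coefficient (previous≉0 j (pred< j+1<n))
      (trans (previous≈ j) (odd-area j (pred< j+1<n))) (step (suc j) (s≤s z≤n) j+1<n)
      (odd≉0 (suc j) j+1<n)

mainTheorem1 : {c ℓ : Level} (F : Field c ℓ) →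
    let open Field F
        open Plane F
    in
    (O : Pt) (n : ℕ) → 1 ≤ n →
    (a : ℕ → Carrier) →
    (∀ k → k < n → ¬ a (2 *ℕ k +ℕ 1) ≈ 0#) →
    (A₀ v : Pt) → ¬ cross (vec O A₀) v ≈ 0# →
    -- the number λ in the construction of A₁ exists and is unique
    ∃!≈ (λ t → cross (vec O A₀) (vec O (A₀ +ᵥ t · v)) ≈ a 1)
    ×
    -- any sequence of points built by the construction satisfies the identities
    ((t : Carrier) (A : ℕ → Pt) →
      cross (vec O A₀) (vec O (A₀ +ᵥ t · v)) ≈ a 1 →
      A 0 ≋ A₀ →
      A 1 ≋ (A₀ +ᵥ t · v) →
      (∀ k → 1 ≤ k → k < n →
        let P = A k +ᵥ (a (2 *ℕ k ∸ 1)) ⁻¹ · vec (A (k ∸ 1)) (A k)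
            Q = P +ᵥ a (2 *ℕ k) · vec O (A k)
        in A (suc k) ≋ (A k +ᵥ a (2 *ℕ k +ℕ 1) · vec (A k) Q)) →
      (∀ k → k < n → a (2 *ℕ k +ℕ 1) ≈ cross (vec O (A k)) (vec O (A (suc k))))
      ×
      (∀ k → 1 ≤ k → k < n →
        a (2 *ℕ k) ≈ cross (vec (A k) (A (k ∸ 1))) (vec (A k) (A (suc k)))
                       * ((a (2 *ℕ k ∸ 1)) ⁻¹ * (a (2 *ℕ k +ℕ 1)) ⁻¹)))
mainTheorem1 F O n _ a odd≉0 A₀ v OA₀×v≉0 =
  firstStep-unique ,
  λ t A first A₀≋ A₁≋ step →
    let first-area = initial-area first A₀≋ A₁≋
    in odd-area O n a A odd≉0 first-area step , even-coefficient O n a A odd≉0 first-area step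
  where
  open Field F
  open Plane F
  open FieldLemmas F
  open ConstructionGeometry F
  open Recurrence F

  firstStep-unique : ∃!≈ (λ t → cross (vec O A₀) (vec O (A₀ +ᵥ t · v)) ≈ a 1)
  firstStep-unique = ∃!≈-cong (λ t → trans (cross-vec-+ᵥ O A₀ v t))
                              (λ t → trans (sym (cross-vec-+ᵥ O A₀ v t)))
                              (linear-∃!≈ OA₀×v≉0 (a 1))

  initial-area : ∀ {t X Y} → cross (vec O A₀) (vec O (A₀ +ᵥ t · v)) ≈ a 1 →
    X ≋ A₀ → Y ≋ (A₀ +ᵥ t · v) → a 1 ≈ cross (vec O X) (vec O Y)
  initial-area first X≋ Y≋ = sym (trans (cross-cong (vec-cong ≋-refl X≋) (vec-cong ≋-refl Y≋)) first)
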